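{- For every $f\in\mathbb{Z}[q,q^{ -1}][x_1^{\pm1},\dots,x_\ell^{\pm1}]$ and every $i\in\{1,\dots,\ell-2\}$, $\pi_{i+1}\Phi(f)=\Phi\pi_i(f)$. Consequently, for every $v$ in the submonoid of $H_\ell$ generated by $\bar s_1,\dots,\bar s_{\ell-2}$, writing $v=\bar s_{i_1}\cdots\bar s_{i_m}$ and $\tau v\tau^{ -1}:=\bar s_{i_1+1}\cdots\bar s_{i_m+1}$, one has $\pi_{\tau v\tau^{ -1}}\Phi(f)=\Phi\pi_v(f)$.
   Context: $\pi_i(f)=\frac{x_if-x_{i+1}s_i(f)}{x_i-x_{i+1}}$ where $s_i$ swaps $x_i,x_{i+1}$; $H_\ell$ is the 0-Hecke monoid on $\bar s_1,\dots,\bar s_{\ell-1}$ (relations $\bar s_i^2=\bar s_i$, $\bar s_i\bar s_j=\bar s_j\bar s_i$ for $|i-j|>1$, braid relations), $\pi_w=\pi_{i_1}\cdots\pi_{i_m}$ for $w=\bar s_{i_1}\cdots\bar s_{i_m}$ (well defined). $\Phi$ is the $\mathbb{Z}[q,q^{ -1}]$-algebra homomorphism with $\Phi(x_i)=x_{i+1}$ for $i\in[\ell-1]$ and $\Phi(x_\ell)=qx_1$. -}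

module Defs where

open import Data.Nat using (ℕ; zero; suc; _∸_; _≤_)
open import Data.Integer as ℤ using (ℤ; +_; -_)
open import Data.Vec using (Vec; []; _∷_; zipWith; replicate; last; init)
open import Data.Vec.Properties using (≡-dec)
open import Data.List using (List; []; _∷_; map; concatMap; _++_)
open import Data.List.Relation.Unary.All using (All)
open import Data.Product using (_×_; ∃)
open import Relation.Binary.PropositionalEquality using (_≡_)
open import Relation.Nullary using (yes; no)

-- The Laurent polynomial ring  ℤ[q,q⁻¹][x₁^{±1},…,x_ℓ^{±1}].
-- An element is a finite formal sum of monomials  c · q^a · x^e
-- (c ∈ ℤ, a ∈ ℤ, e ∈ ℤ^ℓ); two sums are equal (≈) iff they have
-- the same coefficient at every monomial q^a x^e.

record Mono (ℓ : ℕ) : Set where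
  constructor mono
  field
    coef : ℤ
    qexp : ℤ
    xexp : Vec ℤ ℓ

LPoly : ℕ → Set
LPoly ℓ = List (Mono ℓ)

coeff : ∀ {ℓ} → LPoly ℓ → ℤ → Vec ℤ ℓ → ℤ
coeff [] a e = + 0
coeff (mono c b d ∷ f) a e with b ℤ.≟ a | ≡-dec ℤ._≟_ d e
... | yes _ | yes _ = c ℤ.+ coeff f a e
... | _     | _     = coeff f a e

infix 4 _≈_
_≈_ : ∀ {ℓ} → LPoly ℓ → LPoly ℓ → Set
f ≈ g = ∀ a e → coeff f a e ≡ coeff g a e

infixl 6 _+ₚ_ _-ₚ_
infixl 7 _*ₚ_

_+ₚ_ : ∀ {ℓ} → LPoly ℓ → LPoly ℓ → LPoly ℓ
f +ₚ g = f ++ g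

negₚ : ∀ {ℓ} → LPoly ℓ → LPoly ℓ
negₚ = map (λ { (mono c a e) → mono (- c) a e })

_-ₚ_ : ∀ {ℓ} → LPoly ℓ → LPoly ℓ → LPoly ℓ
f -ₚ g = f +ₚ negₚ g

mulMono : ∀ {ℓ} → Mono ℓ → Mono ℓ → Mono ℓ
mulMono (mono c a e) (mono d b e′) = mono (c ℤ.* d) (a ℤ.+ b) (zipWith ℤ._+_ e e′)

_*ₚ_ : ∀ {ℓ} → LPoly ℓ → LPoly ℓ → LPoly ℓ
f *ₚ g = concatMap (λ m → map (mulMono m) g) f

-- 0-based unit exponent vector (position k gets exponent 1)
unitVec : ∀ {ℓ} → ℕ → Vec ℤ ℓ
unitVec {zero}  _       = []
unitVec {suc ℓ} zero    = + 1 ∷ replicate ℓ (+ 0)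
unitVec {suc ℓ} (suc k) = + 0 ∷ unitVec k

-- the variable x_i (1-based index i, meaningful for 1 ≤ i ≤ ℓ)
x : ∀ {ℓ} → ℕ → LPoly ℓ
x i = mono (+ 1) (+ 0) (unitVec (i ∸ 1)) ∷ []

swapAt : ∀ {ℓ} → ℕ → Vec ℤ ℓ → Vec ℤ ℓ
swapAt zero    (a ∷ b ∷ v) = b ∷ a ∷ v
swapAt (suc k) (a ∷ v)     = a ∷ swapAt k v
swapAt _       v           = v

s : ∀ {ℓ} → ℕ → LPoly ℓ → LPoly ℓ
s i = map (λ { (mono c a e) → mono c a (swapAt (i ∸ 1) e) })

-- g = π_i(f)  where  π_i(f) = (x_i f − x_{i+1} s_i(f)) / (x_i − x_{i+1}),
-- i.e. (x_i − x_{i+1}) g = x_i f − x_{i+1} s_i(f)   (the ring is a domain,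
-- so this determines g uniquely).
IsPi : ∀ {ℓ} → ℕ → LPoly ℓ → LPoly ℓ → Set
IsPi i f g = (x i -ₚ x (suc i)) *ₚ g ≈ x i *ₚ f -ₚ x (suc i) *ₚ s i f

-- g = π_{i₁} π_{i₂} ⋯ π_{i_m} (f)  for the word  i₁ i₂ … i_m
data IsPiWord {ℓ : ℕ} : List ℕ → LPoly ℓ → LPoly ℓ → Set where
  pi-nil  : ∀ {f g} → g ≈ f → IsPiWord [] f g
  pi-cons : ∀ {i w f h g} → IsPiWord w f h → IsPi i h g → IsPiWord (i ∷ w) f g

-- Φ : x_i ↦ x_{i+1} (i < ℓ), x_ℓ ↦ q x_1, q ↦ q  (ℤ[q,q⁻¹]-algebra hom).
-- On a monomial q^a x^(e₁,…,e_ℓ) this gives q^(a+e_ℓ) x^(e_ℓ,e₁,…,e_{ℓ-1}).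
ΦMono : ∀ {ℓ} → Mono ℓ → Mono ℓ
ΦMono {zero}  m            = m
ΦMono {suc ℓ} (mono c a e) = mono c (a ℤ.+ last e) (last e ∷ init e)

Φ : ∀ {ℓ} → LPoly ℓ → LPoly ℓ
Φ = map ΦMono

InRange : ℕ → ℕ → Set
InRange ℓ i = 1 ≤ i × i ≤ ℓ ∸ 2

-- Φ acts on monomials by the invertible, additive relabelling of exponents
-- (a , e₁ … e_ℓ) ↦ (a + e_ℓ , e_ℓ e₁ … e_{ℓ-1}).  Hence on formal sums it is,
-- on the nose, additive, multiplicative and negation-preserving, and it respects
-- equality of coefficients.  Away from the last variable it shifts indices:
-- Φ xᵢ = x_{i+1} and Φ ∘ sᵢ = s_{i+1} ∘ Φ for i ≤ ℓ - 2.  Applying Φ to the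
-- defining identity (xᵢ - x_{i+1}) πᵢ f = xᵢ f - x_{i+1} sᵢ f therefore yields
-- the defining identity of π_{i+1} (Φ f); the statement for words follows by
-- induction on the word.
module Submission where

open import Defs
open import Data.Nat using (ℕ; zero; suc; _<_; s≤s)
open import Data.Nat.Properties using (m<n⇒m<1+n)
open import Data.Integer as ℤ using (ℤ; +_)
import Data.Integer.Properties as ℤP
open import Data.Vec using (Vec; []; _∷_; _∷ʳ_; init; last; initLast; zipWith; replicate)
open import Data.Vec.Properties using (init-∷ʳ; last-∷ʳ)
import Data.Vec.Properties as Vecₚ
open import Data.List using (List; []; _∷_; map; _++_)
open import Data.List.Properties using (map-++; map-∘; map-cong; map-id)
open import Data.List.Relation.Unary.All using (All; []; _∷_)
open import Data.Product using (_×_; _,_; proj₁; proj₂; map₂)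
import Data.Product.Properties as Productₚ
open import Function using (_∘_)
open import Relation.Nullary using (yes; no)
open import Relation.Nullary.Negation using (contradiction)
open import Relation.Binary.Definitions using (DecidableEquality)
open import Relation.Binary.PropositionalEquality
open import Algebra.Properties.CommutativeSemigroup ℤP.+-commutativeSemigroup using (interchange)
open import Algebra.Properties.AbelianGroup ℤP.+-0-abelianGroup using (//-rightDividesˡ; //-rightDividesʳ)
open ≡-Reasoning
open Mono using (coef)

private
  variable
    ℓ n : ℕ

Exponent : ℕ → Set
Exponent ℓ = ℤ × Vec ℤ ℓ

exponent : Mono ℓ → Exponent ℓ
exponent (mono _ a e) = a , e

coeffAt : LPoly ℓ → Exponent ℓ → ℤ
coeffAt f (a , e) = coeff f a e

_≟ₑ_ : DecidableEquality (Exponent ℓ)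
_≟ₑ_ = Productₚ.≡-dec ℤ._≟_ (Vecₚ.≡-dec ℤ._≟_)

_⊕_ : Exponent ℓ → Exponent ℓ → Exponent ℓ
(a , e) ⊕ (b , e′) = a ℤ.+ b , zipWith ℤ._+_ e e′

reindex : (Exponent ℓ → Exponent ℓ) → Mono ℓ → Mono ℓ
reindex σ (mono c a e) = mono c (proj₁ (σ (a , e))) (proj₂ (σ (a , e)))

coeffAt-∷-≡ : ∀ (m : Mono ℓ) f p → exponent m ≡ p → coeffAt (m ∷ f) p ≡ coef m ℤ.+ coeffAt f p
coeffAt-∷-≡ (mono c a e) f (a , e) refl with a ℤ.≟ a | Vecₚ.≡-dec ℤ._≟_ e e
... | yes _   | yes _   = refl
... | no a≢a  | _       = contradiction refl a≢a
... | yes _   | no e≢e  = contradiction refl e≢e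

coeffAt-∷-≢ : ∀ (m : Mono ℓ) f p → exponent m ≢ p → coeffAt (m ∷ f) p ≡ coeffAt f p
coeffAt-∷-≢ (mono c b d) f (a , e) m≢p with b ℤ.≟ a | Vecₚ.≡-dec ℤ._≟_ d e
... | yes refl | yes refl = contradiction refl m≢p
... | no _     | _        = refl
... | yes _    | no _     = refl

module _ (σ τ : Exponent ℓ → Exponent ℓ)
         (τ∘σ : ∀ p → τ (σ p) ≡ p) (σ∘τ : ∀ p → σ (τ p) ≡ p) where

  coeffAt-reindex : ∀ f p → coeffAt (map (reindex σ) f) p ≡ coeffAt f (τ p)
  coeffAt-reindex []      p = refl
  coeffAt-reindex (m ∷ f) p with exponent m ≟ₑ τ p
  ... | yes m≡τp = begin
    coeffAt (reindex σ m ∷ map (reindex σ) f) p  ≡⟨ coeffAt-∷-≡ (reindex σ m) _ p (trans (cong σ m≡τp) (σ∘τ p)) ⟩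
    coef m ℤ.+ coeffAt (map (reindex σ) f) p     ≡⟨ cong (ℤ._+_ (coef m)) (coeffAt-reindex f p) ⟩
    coef m ℤ.+ coeffAt f (τ p)                   ≡⟨ coeffAt-∷-≡ m f (τ p) m≡τp ⟨
    coeffAt (m ∷ f) (τ p)                        ∎
  ... | no m≢τp = begin
    coeffAt (reindex σ m ∷ map (reindex σ) f) p  ≡⟨ coeffAt-∷-≢ (reindex σ m) _ p σm≢p ⟩
    coeffAt (map (reindex σ) f) p                ≡⟨ coeffAt-reindex f p ⟩
    coeffAt f (τ p)                              ≡⟨ coeffAt-∷-≢ m f (τ p) m≢τp ⟨
    coeffAt (m ∷ f) (τ p)                        ∎
    where
    σm≢p : σ (exponent m) ≢ p
    σm≢p σm≡p = m≢τp (trans (sym (τ∘σ (exponent m))) (cong τ σm≡p))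

  reindex-resp-≈ : ∀ f g → f ≈ g → map (reindex σ) f ≈ map (reindex σ) g
  reindex-resp-≈ f g f≈g a e = begin
    coeffAt (map (reindex σ) f) (a , e) ≡⟨ coeffAt-reindex f (a , e) ⟩
    coeffAt f (τ (a , e))               ≡⟨ f≈g _ _ ⟩
    coeffAt g (τ (a , e))               ≡⟨ coeffAt-reindex g (a , e) ⟨
    coeffAt (map (reindex σ) g) (a , e) ∎

map-commute : ∀ {A B : Set} {h : A → B} {k : A → A} {k′ : B → B} →
              (∀ x → h (k x) ≡ k′ (h x)) → ∀ xs → map h (map k xs) ≡ map k′ (map h xs)
map-commute {h = h} {k} {k′} h∘k≗k′∘h xs = begin
  map h (map k xs)  ≡⟨ map-∘ xs ⟨
  map (h ∘ k) xs    ≡⟨ map-cong h∘k≗k′∘h xs ⟩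
  map (k′ ∘ h) xs   ≡⟨ map-∘ xs ⟩
  map k′ (map h xs) ∎

reindex-negₚ : ∀ (σ : Exponent ℓ → Exponent ℓ) f → map (reindex σ) (negₚ f) ≡ negₚ (map (reindex σ) f)
reindex-negₚ σ = map-commute (λ _ → refl)

reindex--ₚ : ∀ (σ : Exponent ℓ → Exponent ℓ) f g →
             map (reindex σ) (f -ₚ g) ≡ map (reindex σ) f -ₚ map (reindex σ) g
reindex--ₚ σ f g = begin
  map (reindex σ) (f ++ negₚ g)                  ≡⟨ map-++ (reindex σ) f (negₚ g) ⟩
  map (reindex σ) f ++ map (reindex σ) (negₚ g)  ≡⟨ cong (map (reindex σ) f ++_) (reindex-negₚ σ g) ⟩
  map (reindex σ) f -ₚ map (reindex σ) g         ∎

module _ (σ : Exponent ℓ → Exponent ℓ) (σ-⊕ : ∀ p p′ → σ (p ⊕ p′) ≡ σ p ⊕ σ p′) where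

  reindex-mulMono : ∀ m m′ → reindex σ (mulMono m m′) ≡ mulMono (reindex σ m) (reindex σ m′)
  reindex-mulMono (mono c a e) (mono d b e′) =
    cong (λ p → mono (c ℤ.* d) (proj₁ p) (proj₂ p)) (σ-⊕ (a , e) (b , e′))

  reindex-*ₚ : ∀ f g → map (reindex σ) (f *ₚ g) ≡ map (reindex σ) f *ₚ map (reindex σ) g
  reindex-*ₚ []      g = refl
  reindex-*ₚ (m ∷ f) g = begin
    map (reindex σ) (map (mulMono m) g ++ f *ₚ g)
      ≡⟨ map-++ (reindex σ) (map (mulMono m) g) (f *ₚ g) ⟩
    map (reindex σ) (map (mulMono m) g) ++ map (reindex σ) (f *ₚ g)
      ≡⟨ cong₂ _++_ (map-commute (reindex-mulMono m) g) (reindex-*ₚ f g) ⟩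
    map (mulMono (reindex σ m)) (map (reindex σ) g) ++ map (reindex σ) f *ₚ map (reindex σ) g ∎

reindex-comm : ∀ {σ σ′ τ τ′ : Exponent ℓ → Exponent ℓ} → (∀ p → σ (σ′ p) ≡ τ (τ′ p)) →
               ∀ m → reindex σ (reindex σ′ m) ≡ reindex τ (reindex τ′ m)
reindex-comm σ∘σ′≗τ∘τ′ (mono c a e) = cong (λ p → mono c (proj₁ p) (proj₂ p)) (σ∘σ′≗τ∘τ′ (a , e))

replicate-∷ʳ : ∀ {A : Set} m (v : A) → replicate (suc m) v ≡ replicate m v ∷ʳ v
replicate-∷ʳ zero    v = refl
replicate-∷ʳ (suc m) v = cong (v ∷_) (replicate-∷ʳ m v)

zipWith-∷ʳ : ∀ {A B C : Set} (_∙_ : A → B → C) (u : Vec A n) (v : Vec B n) a b →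
             zipWith _∙_ (u ∷ʳ a) (v ∷ʳ b) ≡ zipWith _∙_ u v ∷ʳ (a ∙ b)
zipWith-∷ʳ _∙_ []      []      a b = refl
zipWith-∷ʳ _∙_ (c ∷ u) (d ∷ v) a b = cong ((c ∙ d) ∷_) (zipWith-∷ʳ _∙_ u v a b)

unitVec-∷ʳ : ∀ {k} → k < n → unitVec {suc n} k ≡ unitVec {n} k ∷ʳ + 0
unitVec-∷ʳ {suc m} {zero}  _          = cong (+ 1 ∷_) (replicate-∷ʳ m (+ 0))
unitVec-∷ʳ {suc m} {suc k} (s≤s k<m) = cong (+ 0 ∷_) (unitVec-∷ʳ k<m)

swapAt-∷ʳ : ∀ {k} → suc k < n → ∀ (v : Vec ℤ n) a → swapAt k (v ∷ʳ a) ≡ swapAt k v ∷ʳ a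
swapAt-∷ʳ {k = zero}  (s≤s (s≤s _)) (b ∷ c ∷ v) a = refl
swapAt-∷ʳ {k = suc k} (s≤s k<n)     (b ∷ v)     a = cong (b ∷_) (swapAt-∷ʳ k<n v a)

elim-∷ʳ : ∀ {A : Set} (P : Vec A (suc n) → Set) → (∀ t a → P (t ∷ʳ a)) → ∀ v → P v
elim-∷ʳ P P-∷ʳ v with initLast v
... | t , a , refl = P-∷ʳ t a

-- ΦMono {suc n} is reindex rotate by definition, so Φ = map (reindex rotate) on LPoly (suc n).
rotate : Exponent (suc n) → Exponent (suc n)
rotate (a , e) = a ℤ.+ last e , last e ∷ init e

unrotate : Exponent (suc n) → Exponent (suc n)
unrotate (a , h ∷ t) = a ℤ.- h , t ∷ʳ h

rotate-∷ʳ : ∀ a (t : Vec ℤ n) h → rotate (a , t ∷ʳ h) ≡ (a ℤ.+ h , h ∷ t)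
rotate-∷ʳ a t h = cong₂ (λ h′ t′ → a ℤ.+ h′ , h′ ∷ t′) (last-∷ʳ h t) (init-∷ʳ h t)

unrotate∘rotate : ∀ (p : Exponent (suc n)) → unrotate (rotate p) ≡ p
unrotate∘rotate (a , e) = elim-∷ʳ (λ v → unrotate (rotate (a , v)) ≡ (a , v)) snoc-case e
  where
  snoc-case : ∀ t h → unrotate (rotate (a , t ∷ʳ h)) ≡ (a , t ∷ʳ h)
  snoc-case t h = begin
    unrotate (rotate (a , t ∷ʳ h)) ≡⟨ cong unrotate (rotate-∷ʳ a t h) ⟩
    (a ℤ.+ h ℤ.- h , t ∷ʳ h)       ≡⟨ cong (_, t ∷ʳ h) (//-rightDividesʳ h a) ⟩
    (a , t ∷ʳ h)                   ∎

rotate∘unrotate : ∀ (p : Exponent (suc n)) → rotate (unrotate p) ≡ p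
rotate∘unrotate (a , h ∷ t) = begin
  rotate (a ℤ.- h , t ∷ʳ h) ≡⟨ rotate-∷ʳ (a ℤ.- h) t h ⟩
  (a ℤ.- h ℤ.+ h , h ∷ t)   ≡⟨ cong (_, h ∷ t) (//-rightDividesˡ h a) ⟩
  (a , h ∷ t)               ∎

rotate-⊕ : ∀ (p p′ : Exponent (suc n)) → rotate (p ⊕ p′) ≡ rotate p ⊕ rotate p′
rotate-⊕ (a , e) (b , e′) =
  elim-∷ʳ (λ v → ∀ v′ → rotate ((a , v) ⊕ (b , v′)) ≡ rotate (a , v) ⊕ rotate (b , v′))
          (λ t h → elim-∷ʳ _ (snoc-case t h)) e e′
  where
  snoc-case : ∀ t h t′ h′ → rotate ((a , t ∷ʳ h) ⊕ (b , t′ ∷ʳ h′)) ≡ rotate (a , t ∷ʳ h) ⊕ rotate (b , t′ ∷ʳ h′)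
  snoc-case t h t′ h′ = begin
    rotate (a ℤ.+ b , zipWith ℤ._+_ (t ∷ʳ h) (t′ ∷ʳ h′))
      ≡⟨ cong (λ v → rotate (a ℤ.+ b , v)) (zipWith-∷ʳ ℤ._+_ t t′ h h′) ⟩
    rotate (a ℤ.+ b , zipWith ℤ._+_ t t′ ∷ʳ (h ℤ.+ h′))
      ≡⟨ rotate-∷ʳ (a ℤ.+ b) (zipWith ℤ._+_ t t′) (h ℤ.+ h′) ⟩
    ((a ℤ.+ b) ℤ.+ (h ℤ.+ h′) , (h ℤ.+ h′) ∷ zipWith ℤ._+_ t t′)
      ≡⟨ cong (_, (h ℤ.+ h′) ∷ zipWith ℤ._+_ t t′) (interchange a b h h′) ⟩
    (a ℤ.+ h , h ∷ t) ⊕ (b ℤ.+ h′ , h′ ∷ t′)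
      ≡⟨ cong₂ _⊕_ (rotate-∷ʳ a t h) (rotate-∷ʳ b t′ h′) ⟨
    rotate (a , t ∷ʳ h) ⊕ rotate (b , t′ ∷ʳ h′) ∎

rotate-unitVec : ∀ {k} → k < n → rotate (+ 0 , unitVec {suc n} k) ≡ (+ 0 , unitVec (suc k))
rotate-unitVec {k = k} k<n = begin
  rotate (+ 0 , unitVec k)          ≡⟨ cong (λ v → rotate (+ 0 , v)) (unitVec-∷ʳ k<n) ⟩
  rotate (+ 0 , unitVec k ∷ʳ + 0)   ≡⟨ rotate-∷ʳ (+ 0) (unitVec k) (+ 0) ⟩
  (+ 0 , + 0 ∷ unitVec k)           ∎

rotate-swapAt : ∀ {k} → suc k < n → ∀ (p : Exponent (suc n)) →
                rotate (map₂ (swapAt k) p) ≡ map₂ (swapAt (suc k)) (rotate p)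
rotate-swapAt {k = k} k+1<n (a , e) =
  elim-∷ʳ (λ v → rotate (a , swapAt k v) ≡ map₂ (swapAt (suc k)) (rotate (a , v))) snoc-case e
  where
  snoc-case : ∀ t h → rotate (a , swapAt k (t ∷ʳ h)) ≡ map₂ (swapAt (suc k)) (rotate (a , t ∷ʳ h))
  snoc-case t h = begin
    rotate (a , swapAt k (t ∷ʳ h))              ≡⟨ cong (λ v → rotate (a , v)) (swapAt-∷ʳ k+1<n t h) ⟩
    rotate (a , swapAt k t ∷ʳ h)                ≡⟨ rotate-∷ʳ a (swapAt k t) h ⟩
    (a ℤ.+ h , h ∷ swapAt k t)                  ≡⟨ cong (map₂ (swapAt (suc k))) (rotate-∷ʳ a t h) ⟨
    map₂ (swapAt (suc k)) (rotate (a , t ∷ʳ h)) ∎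

Φ-resp-≈ : ∀ (f g : LPoly ℓ) → f ≈ g → Φ f ≈ Φ g
Φ-resp-≈ {zero}  f g f≈g = subst₂ _≈_ (sym (map-id f)) (sym (map-id g)) f≈g
Φ-resp-≈ {suc n} = reindex-resp-≈ rotate unrotate unrotate∘rotate rotate∘unrotate

Φ--ₚ : ∀ (f g : LPoly (suc n)) → Φ (f -ₚ g) ≡ Φ f -ₚ Φ g
Φ--ₚ = reindex--ₚ rotate

Φ-*ₚ : ∀ (f g : LPoly (suc n)) → Φ (f *ₚ g) ≡ Φ f *ₚ Φ g
Φ-*ₚ = reindex-*ₚ rotate rotate-⊕

Φ-x : ∀ {k} → k < n → Φ (x {suc n} (suc k)) ≡ x (suc (suc k))
Φ-x k<n = cong (λ p → mono (+ 1) (proj₁ p) (proj₂ p) ∷ []) (rotate-unitVec k<n)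

Φ-s : ∀ {k} → suc k < n → ∀ (f : LPoly (suc n)) → Φ (s (suc k) f) ≡ s (suc (suc k)) (Φ f)
Φ-s {k = k} k+1<n = map-commute (reindex-comm {σ = rotate} {map₂ (swapAt k)} {map₂ (swapAt (suc k))} {rotate} (rotate-swapAt k+1<n))

Φ-IsPi : ∀ {i} → InRange ℓ i → ∀ (f g : LPoly ℓ) → IsPi i f g → IsPi (suc i) (Φ f) (Φ g)
Φ-IsPi {suc (suc n)} {suc k} (_ , k<n) f g πf≡g =
  subst₂ _≈_ lhs rhs (Φ-resp-≈ ((xᵢ -ₚ xᵢ₊₁) *ₚ g) (xᵢ *ₚ f -ₚ xᵢ₊₁ *ₚ s (suc k) f) πf≡g)
  where
  xᵢ xᵢ₊₁ xᵢ₊₂ : LPoly (suc (suc n))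
  xᵢ   = x (suc k)
  xᵢ₊₁ = x (suc (suc k))
  xᵢ₊₂ = x (suc (suc (suc k)))

  Φxᵢ : Φ xᵢ ≡ xᵢ₊₁
  Φxᵢ = Φ-x (m<n⇒m<1+n k<n)
  Φxᵢ₊₁ : Φ xᵢ₊₁ ≡ xᵢ₊₂
  Φxᵢ₊₁ = Φ-x (s≤s k<n)

  lhs : Φ ((xᵢ -ₚ xᵢ₊₁) *ₚ g) ≡ (xᵢ₊₁ -ₚ xᵢ₊₂) *ₚ Φ g
  lhs = begin
    Φ ((xᵢ -ₚ xᵢ₊₁) *ₚ g)        ≡⟨ Φ-*ₚ (xᵢ -ₚ xᵢ₊₁) g ⟩
    Φ (xᵢ -ₚ xᵢ₊₁) *ₚ Φ g        ≡⟨ cong (_*ₚ Φ g) (Φ--ₚ xᵢ xᵢ₊₁) ⟩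
    (Φ xᵢ -ₚ Φ xᵢ₊₁) *ₚ Φ g      ≡⟨ cong₂ (λ u v → (u -ₚ v) *ₚ Φ g) Φxᵢ Φxᵢ₊₁ ⟩
    (xᵢ₊₁ -ₚ xᵢ₊₂) *ₚ Φ g        ∎

  rhs : Φ (xᵢ *ₚ f -ₚ xᵢ₊₁ *ₚ s (suc k) f) ≡ xᵢ₊₁ *ₚ Φ f -ₚ xᵢ₊₂ *ₚ s (suc (suc k)) (Φ f)
  rhs = begin
    Φ (xᵢ *ₚ f -ₚ xᵢ₊₁ *ₚ s (suc k) f)
      ≡⟨ Φ--ₚ (xᵢ *ₚ f) (xᵢ₊₁ *ₚ s (suc k) f) ⟩
    Φ (xᵢ *ₚ f) -ₚ Φ (xᵢ₊₁ *ₚ s (suc k) f)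
      ≡⟨ cong₂ _-ₚ_ (Φ-*ₚ xᵢ f) (Φ-*ₚ xᵢ₊₁ (s (suc k) f)) ⟩
    Φ xᵢ *ₚ Φ f -ₚ Φ xᵢ₊₁ *ₚ Φ (s (suc k) f)
      ≡⟨ cong₂ (λ u v → u *ₚ Φ f -ₚ v *ₚ Φ (s (suc k) f)) Φxᵢ Φxᵢ₊₁ ⟩
    xᵢ₊₁ *ₚ Φ f -ₚ xᵢ₊₂ *ₚ Φ (s (suc k) f)
      ≡⟨ cong (λ u → xᵢ₊₁ *ₚ Φ f -ₚ xᵢ₊₂ *ₚ u) (Φ-s (s≤s k<n) f) ⟩
    xᵢ₊₁ *ₚ Φ f -ₚ xᵢ₊₂ *ₚ s (suc (suc k)) (Φ f) ∎

Φ-IsPiWord : ∀ {w} → All (InRange ℓ) w → ∀ (f g : LPoly ℓ) → IsPiWord w f g → IsPiWord (map suc w) (Φ f) (Φ g)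
Φ-IsPiWord []       f g (pi-nil g≈f)               = pi-nil (Φ-resp-≈ g f g≈f)
Φ-IsPiWord (r ∷ rs) f g (pi-cons {h = h} πw πi) = pi-cons (Φ-IsPiWord rs f h πw) (Φ-IsPi r h g πi)

proposition5p7 : (ℓ : ℕ) →
    ((i : ℕ) → InRange ℓ i → (f g : LPoly ℓ) → IsPi i f g → IsPi (suc i) (Φ f) (Φ g))
    × ((w : List ℕ) → All (InRange ℓ) w → (f g : LPoly ℓ) →
         IsPiWord w f g → IsPiWord (map suc w) (Φ f) (Φ g))
proposition5p7 ℓ = (λ i → Φ-IsPi) , (λ w → Φ-IsPiWord)
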